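{- Let $l\geq 2$ be an integer and $d$ a positive integer. Let $J$ and $I$ denote the $l\times l$ all-ones and identity matrices, $\mathbf{1}$ the all-ones column vector of length $l$, and let $A$ be the $(2l+1)\times(2l+1)$ symmetric matrix \[A=\begin{pmatrix} 2d(J-I) & (d+1)(J-I) & d\,\mathbf{1}\\ (d+1)(J-I) & \mathbf{0} & \mathbf{0}\\ d\,\mathbf{1}^{T} & \mathbf{0} & 0\end{pmatrix}.\] Then the sum of all $(2l-1)\times(2l-1)$ principal minors of $A$ is nonzero.
   Context: A principal minor of a square matrix is the determinant of a submatrix obtained by deleting a set of rows and the same set of columns. -}

module Defs where

open import Data.Nat using (ℕ; zero; suc; _≤_; _<_)
open import Data.Fin using (Fin; zero; suc; punchIn; toℕ; splitAt; inject≤)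
open import Data.Integer using (ℤ; +_; _+_; _*_; -_; 0ℤ; 1ℤ)
open import Data.List using (List; []; _∷_; _++_; map; foldr)
open import Data.Sum using (inj₁; inj₂)
open import Function using (_∘_)

Matrix : ℕ → Set
Matrix n = Fin n → Fin n → ℤ

∑ : ∀ {n} → (Fin n → ℤ) → ℤ
∑ {zero}  f = 0ℤ
∑ {suc n} f = f zero + ∑ (f ∘ suc)

sgn : ℕ → ℤ
sgn zero          = 1ℤ
sgn (suc zero)    = - 1ℤ
sgn (suc (suc i)) = sgn i

det : ∀ n → Matrix n → ℤ
det zero    M = 1ℤ
det (suc n) M =
  ∑ (λ j → sgn (toℕ j) * (M zero j * det n (λ r c → M (suc r) (punchIn j c))))

-- All strictly increasing maps Fin k → Fin n (i.e. all k-element index sets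
-- of Fin n, each listed exactly once, in increasing order).
increasing : ∀ n k → List (Fin k → Fin n)
increasing n       zero    = (λ ()) ∷ []
increasing zero    (suc k) = []
increasing (suc n) (suc k) =
  map (λ σ → suc ∘ σ) (increasing n (suc k)) ++
  map (λ σ → λ { zero → zero ; (suc i) → suc (σ i) }) (increasing n k)

principalSubmatrix : ∀ {n k} → Matrix n → (Fin k → Fin n) → Matrix k
principalSubmatrix M σ i j = M (σ i) (σ j)

sumPrincipalMinors : ∀ n k → Matrix n → ℤ
sumPrincipalMinors n k M =
  foldr _+_ 0ℤ (map (λ σ → det k (principalSubmatrix M σ)) (increasing n k))

data Block (l : ℕ) : Set where
  blk₁ : Fin l → Block l
  blk₂ : Fin l → Block l
  blk₃ : Block l

block : ∀ l → Fin (l Data.Nat.+ (l Data.Nat.+ 1)) → Block l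
block l i with splitAt l i
... | inj₁ a = blk₁ a
... | inj₂ b with splitAt l b
...   | inj₁ c = blk₂ c
...   | inj₂ _ = blk₃

JmI : ∀ {l} → Fin l → Fin l → ℤ
JmI zero    zero    = 0ℤ
JmI zero    (suc _) = 1ℤ
JmI (suc _) zero    = 1ℤ
JmI (suc a) (suc b) = JmI a b

Aentry : (l d : ℕ) → Block l → Block l → ℤ
Aentry l d (blk₁ a) (blk₁ b) = + (2 Data.Nat.* d) * JmI a b
Aentry l d (blk₁ a) (blk₂ b) = + (suc d) * JmI a b
Aentry l d (blk₁ a) blk₃     = + d
Aentry l d (blk₂ a) (blk₁ b) = + (suc d) * JmI a b
Aentry l d (blk₂ a) (blk₂ b) = 0ℤ
Aentry l d (blk₂ a) blk₃     = 0ℤ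
Aentry l d blk₃     (blk₁ b) = + d
Aentry l d blk₃     (blk₂ b) = 0ℤ
Aentry l d blk₃     blk₃     = 0ℤ

A : (l d : ℕ) → Matrix (l Data.Nat.+ (l Data.Nat.+ 1))
A l d i j = Aentry l d (block l i) (block l j)

{-# OPTIONS --safe #-}
module Submission where

-- A (2l−1)-principal minor of A contains a zero block on its rows and columns from
-- blocks 2 and 3; it vanishes unless it uses all l indices of block 1 together with a
-- set T of l − 1 indices from blocks 2 and 3. Such a minor is the bordered determinant
-- of [[2d(J − I), B], [Bᵀ, 0]] with B = A[block 1, T], and Laplace expansion turns it
-- into ±2d · yᵀ(J − I)y, where y is the vector of signed maximal minors of B. Since
-- yᵀB = 0, either y_b = ∑ y for a column b of (d+1)(J − I) or ∑ y = 0 for the column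
-- d·1; in both cases yᵀ(I − J)y = ∑ y² − (∑ y)² ≥ 0. For one T (block 2 without its
-- first index, or block 3 when l = 2) it is positive, as det(J − I) ≠ 0. So the sum
-- is a nonzero constant times a positive integer.

open import Defs
open import Data.Bool using (Bool; true; false; T; not; if_then_else_)
open import Data.Empty using (⊥-elim)
open import Data.Fin using (Fin; zero; suc; punchIn; toℕ; _↑ˡ_; _↑ʳ_)
import Data.Fin.Properties as Fin
open import Data.List using (List; []; _∷_; _++_; length; map; foldr; tabulate)
import Data.List.Properties as List
open import Data.List.Membership.Propositional.Properties using (∈-∃++; ∈-tabulate⁺)
open import Data.List.Relation.Unary.All as All using (All; []; _∷_)
import Data.List.Relation.Unary.All.Properties as All
open import Data.List.Relation.Unary.Any as Any using (Any)
import Data.List.Relation.Unary.Any.Properties as Any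
open import Data.Nat as ℕ using (ℕ; zero; suc; z≤n; s≤s)
import Data.Nat.Properties as ℕ
open import Data.Product using (_×_; _,_)
open import Data.Sum using (_⊎_; inj₁; inj₂)
open import Data.Unit using (tt)
open import Function using (_∘_)
open import Relation.Binary.PropositionalEquality
  using (_≡_; _≢_; ≢-sym; refl; sym; trans; cong; cong₂; subst; module ≡-Reasoning)

-- ℤ's operators are opened only inside this section, so that ℕ's _+_ is free for
-- the statement of lemma4p4.
module _ where
  open import Data.Integer using (ℤ; +_; -[1+_]; -_; _+_; _*_; 0ℤ; 1ℤ; _^_)
  import Data.Integer as ℤ using (_≤_; _<_)
  import Data.Integer.Properties as ℤ
  open import Data.Integer.Tactic.RingSolver using (solve-∀)
  open import Algebra.Properties.CommutativeSemigroup ℤ.+-commutativeSemigroup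
    using (interchange)

  private
    variable
      X Y : Set

  sgn-suc : ∀ n → sgn (suc n) ≡ - sgn n
  sgn-suc zero          = refl
  sgn-suc (suc zero)    = refl
  sgn-suc (suc (suc n)) = sgn-suc n

  sgn-+ : ∀ m n → sgn (m ℕ.+ n) ≡ sgn m * sgn n
  sgn-+ zero    n = sym (ℤ.*-identityˡ (sgn n))
  sgn-+ (suc m) n = begin
    sgn (suc (m ℕ.+ n))  ≡⟨ sgn-suc (m ℕ.+ n) ⟩
    - sgn (m ℕ.+ n)      ≡⟨ cong -_ (sgn-+ m n) ⟩
    - (sgn m * sgn n)    ≡⟨ ℤ.neg-distribˡ-* (sgn m) (sgn n) ⟩
    - sgn m * sgn n      ≡⟨ cong (_* sgn n) (sym (sgn-suc m)) ⟩
    sgn (suc m) * sgn n  ∎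
    where open ≡-Reasoning

  sgn≢0 : ∀ n → sgn n ≢ 0ℤ
  sgn≢0 zero       ()
  sgn≢0 (suc zero) ()
  sgn≢0 (suc (suc n)) = sgn≢0 n

  ∑-cong : ∀ {n} {f g : Fin n → ℤ} → (∀ i → f i ≡ g i) → ∑ f ≡ ∑ g
  ∑-cong {zero}  f≗g = refl
  ∑-cong {suc n} f≗g = cong₂ _+_ (f≗g zero) (∑-cong (f≗g ∘ suc))

  ∑-distrib-+ : ∀ {n} (f g : Fin n → ℤ) → ∑ (λ i → f i + g i) ≡ ∑ f + ∑ g
  ∑-distrib-+ {zero}  f g = refl
  ∑-distrib-+ {suc n} f g =
    trans (cong (_+_ (f zero + g zero)) (∑-distrib-+ (f ∘ suc) (g ∘ suc)))
          (interchange (f zero) (g zero) (∑ (f ∘ suc)) (∑ (g ∘ suc)))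

  *-distribˡ-∑ : ∀ {n} k (f : Fin n → ℤ) → k * ∑ f ≡ ∑ (λ i → k * f i)
  *-distribˡ-∑ {zero}  k f = ℤ.*-zeroʳ k
  *-distribˡ-∑ {suc n} k f =
    trans (ℤ.*-distribˡ-+ k (f zero) (∑ (f ∘ suc)))
          (cong (_+_ (k * f zero)) (*-distribˡ-∑ k (f ∘ suc)))

  ∑-neg : ∀ {n} (f : Fin n → ℤ) → ∑ (λ i → - f i) ≡ - ∑ f
  ∑-neg f = begin
    ∑ (λ i → - f i)       ≡⟨ ∑-cong (λ i → sym (ℤ.-1*i≡-i (f i))) ⟩
    ∑ (λ i → - 1ℤ * f i)  ≡⟨ *-distribˡ-∑ (- 1ℤ) f ⟨
    - 1ℤ * ∑ f            ≡⟨ ℤ.-1*i≡-i (∑ f) ⟩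
    - ∑ f                 ∎
    where open ≡-Reasoning

  ∑-const : ∀ n c → ∑ {n} (λ _ → c) ≡ + n * c
  ∑-const zero    c = refl
  ∑-const (suc n) c = begin
    c + ∑ {n} (λ _ → c)  ≡⟨ cong (_+_ c) (∑-const n c) ⟩
    c + + n * c          ≡⟨ cong (_+ + n * c) (ℤ.*-identityˡ c) ⟨
    1ℤ * c + + n * c     ≡⟨ ℤ.*-distribʳ-+ c 1ℤ (+ n) ⟨
    + suc n * c          ∎
    where open ≡-Reasoning

  -- ∑-pick h xs sums h j x rest over the ways of removing the j-th element x from xs.
  ∑-pick : (ℕ → X → List X → ℤ) → List X → ℤ
  ∑-pick h []       = 0ℤ
  ∑-pick h (x ∷ xs) = h 0 x xs + ∑-pick (λ j y rest → h (suc j) y (x ∷ rest)) xs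

  data Pick {X : Set} : List X → X → List X → Set where
    here  : ∀ {x xs} → Pick (x ∷ xs) x xs
    there : ∀ {x xs y ys} → Pick xs y ys → Pick (x ∷ xs) y (x ∷ ys)

  ∑-pick-cong-on : ∀ {h g : ℕ → X → List X → ℤ} xs →
    (∀ j {c rest} → Pick xs c rest → h j c rest ≡ g j c rest) → ∑-pick h xs ≡ ∑-pick g xs
  ∑-pick-cong-on []       h≗g = refl
  ∑-pick-cong-on (x ∷ xs) h≗g =
    cong₂ _+_ (h≗g 0 here) (∑-pick-cong-on xs (λ j pick → h≗g (suc j) (there pick)))

  ∑-pick-cong : ∀ {h g : ℕ → X → List X → ℤ} xs →
    (∀ j c rest → h j c rest ≡ g j c rest) → ∑-pick h xs ≡ ∑-pick g xs
  ∑-pick-cong xs h≗g = ∑-pick-cong-on xs (λ j {c} {rest} _ → h≗g j c rest)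

  ∑-pick-≡0 : ∀ {h : ℕ → X → List X → ℤ} xs →
    (∀ j {c rest} → Pick xs c rest → h j c rest ≡ 0ℤ) → ∑-pick h xs ≡ 0ℤ
  ∑-pick-≡0 []       h≡0 = refl
  ∑-pick-≡0 (x ∷ xs) h≡0 =
    cong₂ _+_ (h≡0 0 here) (∑-pick-≡0 xs (λ j pick → h≡0 (suc j) (there pick)))

  ∑-pick-distrib-+ : ∀ (h g : ℕ → X → List X → ℤ) xs →
    ∑-pick (λ j c rest → h j c rest + g j c rest) xs ≡ ∑-pick h xs + ∑-pick g xs
  ∑-pick-distrib-+ h g []       = refl
  ∑-pick-distrib-+ h g (x ∷ xs) =
    trans (cong (_+_ (h 0 x xs + g 0 x xs)) (∑-pick-distrib-+ _ _ xs))
          (interchange (h 0 x xs) (g 0 x xs) _ _)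

  *-distribˡ-∑-pick : ∀ k (h : ℕ → X → List X → ℤ) xs →
    k * ∑-pick h xs ≡ ∑-pick (λ j c rest → k * h j c rest) xs
  *-distribˡ-∑-pick k h []       = ℤ.*-zeroʳ k
  *-distribˡ-∑-pick k h (x ∷ xs) =
    trans (ℤ.*-distribˡ-+ k (h 0 x xs) _) (cong (_+_ (k * h 0 x xs)) (*-distribˡ-∑-pick k _ xs))

  ∑-pick-neg : ∀ (h : ℕ → X → List X → ℤ) xs →
    ∑-pick (λ j c rest → - h j c rest) xs ≡ - ∑-pick h xs
  ∑-pick-neg h xs = begin
    ∑-pick (λ j c rest → - h j c rest) xs
      ≡⟨ ∑-pick-cong xs (λ j c rest → sym (ℤ.-1*i≡-i (h j c rest))) ⟩
    ∑-pick (λ j c rest → - 1ℤ * h j c rest) xs  ≡⟨ *-distribˡ-∑-pick (- 1ℤ) h xs ⟨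
    - 1ℤ * ∑-pick h xs                          ≡⟨ ℤ.-1*i≡-i _ ⟩
    - ∑-pick h xs                               ∎
    where open ≡-Reasoning

  ∑-pick-++ : ∀ (h : ℕ → X → List X → ℤ) xs ys →
    ∑-pick h (xs ++ ys) ≡ ∑-pick (λ j c rest → h j c (rest ++ ys)) xs
                        + ∑-pick (λ k c rest → h (length xs ℕ.+ k) c (xs ++ rest)) ys
  ∑-pick-++ h []       ys = sym (ℤ.+-identityˡ _)
  ∑-pick-++ h (x ∷ xs) ys =
    trans (cong (_+_ (h 0 x (xs ++ ys))) (∑-pick-++ _ xs ys)) (sym (ℤ.+-assoc (h 0 x (xs ++ ys)) _ _))

  Pick-length : ∀ {xs : List X} {c rest} → Pick xs c rest → length xs ≡ suc (length rest)
  Pick-length here         = refl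
  Pick-length (there pick) = cong suc (Pick-length pick)

  Pick-All : ∀ {P : X → Set} {xs c rest} → All P xs → Pick xs c rest → All P rest
  Pick-All (_ ∷ pxs)  here         = pxs
  Pick-All (px ∷ pxs) (there pick) = px ∷ Pick-All pxs pick

  ∑-pick-tabulate : ∀ {n} (h : ℕ → X → List X → ℤ) (τ : Fin (suc n) → X) →
    ∑-pick h (tabulate τ) ≡ ∑ (λ j → h (toℕ j) (τ j) (tabulate (τ ∘ punchIn j)))
  ∑-pick-tabulate {n = zero}  h τ = refl
  ∑-pick-tabulate {n = suc n} h τ =
    cong (_+_ (h 0 (τ zero) (tabulate (τ ∘ suc))))
      (trans (∑-pick-tabulate (λ j y rest → h (suc j) y (τ zero ∷ rest)) (τ ∘ suc))
             (∑-cong (λ j → cong (h (suc (toℕ j)) (τ (suc j))) (tabulate-punchIn j))))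
    where
    tabulate-punchIn : ∀ j → τ zero ∷ tabulate (τ ∘ suc ∘ punchIn j) ≡ tabulate (τ ∘ punchIn (suc j))
    tabulate-punchIn zero    = refl
    tabulate-punchIn (suc j) = refl

  ∑-pick-comm : ∀ (g : ℕ → X → List X → ℕ → Y → List Y → ℤ) xs ys →
    ∑-pick (λ j x xs′ → ∑-pick (λ k y ys′ → g j x xs′ k y ys′) ys) xs
      ≡ ∑-pick (λ k y ys′ → ∑-pick (λ j x xs′ → g j x xs′ k y ys′) xs) ys
  ∑-pick-comm g []       ys = sym (∑-pick-≡0 ys (λ _ _ → refl))
  ∑-pick-comm g (x ∷ xs) ys =
    trans (cong (_+_ (∑-pick (g 0 x xs) ys)) (∑-pick-comm _ xs ys)) (sym (∑-pick-distrib-+ _ _ ys))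

  -- Rows and columns are labelled by the elements of two lists, so that block
  -- structure is expressed by concatenation. Expansion is along the first row;
  -- a non-square matrix gets determinant 0.
  detOn : (X → Y → ℤ) → List X → List Y → ℤ
  detOn f []      []      = 1ℤ
  detOn f []      (_ ∷ _) = 0ℤ
  detOn f (r ∷ R) C       = ∑-pick (λ j c C′ → sgn j * (f r c * detOn f R C′)) C

  det≡detOn : ∀ n (f : X → Y → ℤ) (ρ : Fin n → X) (τ : Fin n → Y) →
              det n (λ i j → f (ρ i) (τ j)) ≡ detOn f (tabulate ρ) (tabulate τ)
  det≡detOn zero    f ρ τ = refl
  det≡detOn (suc n) f ρ τ = sym (trans
    (∑-pick-tabulate (λ j c C′ → sgn j * (f (ρ zero) c * detOn f (tabulate (ρ ∘ suc)) C′)) τ)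
    (∑-cong (λ j → cong (λ D → sgn (toℕ j) * (f (ρ zero) (τ j) * D))
                        (sym (det≡detOn n f (ρ ∘ suc) (τ ∘ punchIn j))))))

  detOn-cong : ∀ {f g : X → Y → ℤ} → (∀ x y → f x y ≡ g x y) →
               ∀ R C → detOn f R C ≡ detOn g R C
  detOn-cong f≗g []      []      = refl
  detOn-cong f≗g []      (_ ∷ _) = refl
  detOn-cong f≗g (r ∷ R) C       = ∑-pick-cong C (λ j c C′ →
    cong₂ (λ u v → sgn j * (u * v)) (f≗g r c) (detOn-cong f≗g R C′))

  detOn-expand-column : ∀ (f : X → Y → ℤ) R c C →
    detOn f R (c ∷ C) ≡ ∑-pick (λ i r R′ → sgn i * (f r c * detOn f R′ C)) R
  detOn-expand-column f []      c C = refl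
  detOn-expand-column f (r ∷ R) c C = cong (_+_ (sgn 0 * (f r c * detOn f R C))) (begin
    ∑-pick (λ j x C′ → sgn (suc j) * (f r x * detOn f R (c ∷ C′))) C
      ≡⟨ ∑-pick-cong C (λ j x C′ →
           trans (cong (λ D → sgn (suc j) * (f r x * D)) (detOn-expand-column f R c C′))
                 (distrib₂ (sgn (suc j)) (f r x) _ R)) ⟩
    ∑-pick (λ j x C′ → ∑-pick (λ i s R′ → sgn (suc j) * (f r x * (sgn i * (f s c * detOn f R′ C′)))) R) C
      ≡⟨ ∑-pick-comm _ C R ⟩
    ∑-pick (λ i s R′ → ∑-pick (λ j x C′ → sgn (suc j) * (f r x * (sgn i * (f s c * detOn f R′ C′)))) C) R
      ≡⟨ ∑-pick-cong R (λ i s R′ →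
           trans (∑-pick-cong C (λ j x C′ → exchange i j (f r x) (f s c) (detOn f R′ C′)))
                 (sym (distrib₂ (sgn (suc i)) (f s c) _ C))) ⟩
    ∑-pick (λ i s R′ → sgn (suc i) * (f s c * detOn f (r ∷ R′) C)) R ∎)
    where
    open ≡-Reasoning
    distrib₂ : ∀ {Z : Set} k₁ k₂ (h : ℕ → Z → List Z → ℤ) xs →
      k₁ * (k₂ * ∑-pick h xs) ≡ ∑-pick (λ j x rest → k₁ * (k₂ * h j x rest)) xs
    distrib₂ k₁ k₂ h xs =
      trans (cong (k₁ *_) (*-distribˡ-∑-pick k₂ h xs)) (*-distribˡ-∑-pick k₁ _ xs)
    exchange : ∀ i j a b D →
      sgn (suc j) * (a * (sgn i * (b * D))) ≡ sgn (suc i) * (b * (sgn j * (a * D)))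
    exchange i j a b D rewrite sgn-suc i | sgn-suc j = lemma (sgn i) (sgn j) a b D
      where
      lemma : ∀ s t a b D → - t * (a * (s * (b * D))) ≡ - s * (b * (t * (a * D)))
      lemma = solve-∀

  detOn-transpose : ∀ (f : X → Y → ℤ) R C → detOn f R C ≡ detOn (λ c r → f r c) C R
  detOn-transpose f []      []      = refl
  detOn-transpose f []      (_ ∷ _) = refl
  detOn-transpose f (r ∷ R) C       = trans
    (∑-pick-cong C (λ j c C′ → cong (λ D → sgn j * (f r c * D)) (detOn-transpose f R C′)))
    (sym (detOn-expand-column (λ c r → f r c) C r R))

  detOn-swap : ∀ (f : X → Y → ℤ) R C₁ x y C₂ →
    detOn f R (C₁ ++ x ∷ y ∷ C₂) ≡ - detOn f R (C₁ ++ y ∷ x ∷ C₂)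
  detOn-swap f []      []      x y C₂ = refl
  detOn-swap f []      (_ ∷ _) x y C₂ = refl
  detOn-swap {Y = Y} f (r ∷ R) C₁ x y C₂ = begin
    ∑-pick h (C₁ ++ x ∷ y ∷ C₂)
      ≡⟨ ∑-pick-++ h C₁ (x ∷ y ∷ C₂) ⟩
    ∑-pick (λ j c C′ → h j c (C′ ++ x ∷ y ∷ C₂)) C₁
      + (h (n ℕ.+ 0) x (C₁ ++ y ∷ C₂) + (h (n ℕ.+ 1) y (C₁ ++ x ∷ C₂)
      + ∑-pick (λ k c C′ → h (n ℕ.+ suc (suc k)) c (C₁ ++ x ∷ y ∷ C′)) C₂))
      ≡⟨ cong₂ _+_ (swap-in (λ j → j) (λ C′ → C′) (λ _ → C₂) C₁)
           (cong₂ _+_ (unshift x (C₁ ++ y ∷ C₂))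
             (cong₂ _+_ (shift y (C₁ ++ x ∷ C₂))
               (swap-in (λ k → n ℕ.+ suc (suc k)) (λ _ → C₁) (λ C′ → C′) C₂))) ⟩
    - a + (- q + (- p + - b))
      ≡⟨ regroup a p q b ⟩
    - (a + (p + (q + b)))
      ≡⟨ cong -_ (∑-pick-++ h C₁ (y ∷ x ∷ C₂)) ⟨
    - ∑-pick h (C₁ ++ y ∷ x ∷ C₂) ∎
    where
    open ≡-Reasoning
    n : ℕ
    n = length C₁
    h : ℕ → Y → List Y → ℤ
    h j c C′ = sgn j * (f r c * detOn f R C′)
    a : ℤ
    a = ∑-pick (λ j c C′ → h j c (C′ ++ y ∷ x ∷ C₂)) C₁
    p : ℤ
    p = h (n ℕ.+ 0) y (C₁ ++ x ∷ C₂)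
    q : ℤ
    q = h (n ℕ.+ 1) x (C₁ ++ y ∷ C₂)
    b : ℤ
    b = ∑-pick (λ k c C′ → h (n ℕ.+ suc (suc k)) c (C₁ ++ y ∷ x ∷ C′)) C₂
    regroup : ∀ a p q b → - a + (- q + (- p + - b)) ≡ - (a + (p + (q + b)))
    regroup = solve-∀
    swap-in : ∀ (g : ℕ → ℕ) (D₁ D₂ : List Y → List Y) xs →
      ∑-pick (λ j c C′ → h (g j) c (D₁ C′ ++ x ∷ y ∷ D₂ C′)) xs
        ≡ - ∑-pick (λ j c C′ → h (g j) c (D₁ C′ ++ y ∷ x ∷ D₂ C′)) xs
    swap-in g D₁ D₂ xs = trans
      (∑-pick-cong xs (λ j c C′ → trans
        (cong (λ D → sgn (g j) * (f r c * D)) (detOn-swap f R (D₁ C′) x y (D₂ C′)))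
        (neg-inside (sgn (g j)) (f r c) _)))
      (∑-pick-neg _ xs)
      where
      neg-inside : ∀ s u v → s * (u * - v) ≡ - (s * (u * v))
      neg-inside = solve-∀
    shift : ∀ c C′ → h (n ℕ.+ 1) c C′ ≡ - h (n ℕ.+ 0) c C′
    shift c C′ = trans (cong (λ s → s * (f r c * detOn f R C′)) sgn-n+1)
                       (sym (ℤ.neg-distribˡ-* (sgn (n ℕ.+ 0)) _))
      where
      sgn-n+1 : sgn (n ℕ.+ 1) ≡ - sgn (n ℕ.+ 0)
      sgn-n+1 rewrite ℕ.+-comm n 1 | ℕ.+-identityʳ n = sgn-suc n
    unshift : ∀ c C′ → h (n ℕ.+ 0) c C′ ≡ - h (n ℕ.+ 1) c C′
    unshift c C′ = trans (sym (ℤ.neg-involutive _)) (cong -_ (sym (shift c C′)))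

  zeroʳ₂ : ∀ a b → a * (b * 0ℤ) ≡ 0ℤ
  zeroʳ₂ a b = trans (cong (a *_) (ℤ.*-zeroʳ b)) (ℤ.*-zeroʳ a)

  ≡-neg⇒≡0 : ∀ a → a ≡ - a → a ≡ 0ℤ
  ≡-neg⇒≡0 (+ zero)  _ = refl
  ≡-neg⇒≡0 (+ suc n) ()
  ≡-neg⇒≡0 (-[1+ n ]) ()

  detOn-repeated-column : ∀ (f : X → Y → ℤ) R C₁ x C₂ C₃ →
                          detOn f R (C₁ ++ x ∷ C₂ ++ x ∷ C₃) ≡ 0ℤ
  detOn-repeated-column f R C₁ x []       C₃ = ≡-neg⇒≡0 _ (detOn-swap f R C₁ x x C₃)
  detOn-repeated-column f R C₁ x (y ∷ C₂) C₃ = begin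
    detOn f R (C₁ ++ x ∷ y ∷ C₂ ++ x ∷ C₃)
      ≡⟨ detOn-swap f R C₁ x y (C₂ ++ x ∷ C₃) ⟩
    - detOn f R (C₁ ++ y ∷ x ∷ C₂ ++ x ∷ C₃)
      ≡⟨ cong (-_ ∘ detOn f R) (List.++-assoc C₁ (y ∷ []) _) ⟨
    - detOn f R ((C₁ ++ y ∷ []) ++ x ∷ C₂ ++ x ∷ C₃)
      ≡⟨ cong -_ (detOn-repeated-column f R (C₁ ++ y ∷ []) x C₂ C₃) ⟩
    - 0ℤ ∎
    where open ≡-Reasoning

  alien-expansion : ∀ (f : X → Y → ℤ) R x C₁ C₂ →
    ∑-pick (λ i r R′ → sgn i * (f r x * detOn f R′ (C₁ ++ x ∷ C₂))) R ≡ 0ℤ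
  alien-expansion f R x C₁ C₂ =
    trans (sym (detOn-expand-column f R x (C₁ ++ x ∷ C₂))) (detOn-repeated-column f R [] x C₁ C₂)

  det-scale : ∀ n k (M : Matrix n) → det n (λ i j → k * M i j) ≡ k ^ n * det n M
  det-scale zero    k M = sym (ℤ.*-identityˡ _)
  det-scale (suc n) k M = trans
    (∑-cong (λ j → trans
      (cong (λ D → sgn (toℕ j) * ((k * M zero j) * D)) (det-scale n k (minor j)))
      (regroup (sgn (toℕ j)) k (M zero j) (k ^ n) (det n (minor j)))))
    (sym (*-distribˡ-∑ (k * k ^ n) (λ j → sgn (toℕ j) * (M zero j * det n (minor j)))))
    where
    minor : Fin (suc n) → Matrix n
    minor j r c = M (suc r) (punchIn j c)
    regroup : ∀ s k a p D → s * ((k * a) * (p * D)) ≡ (k * p) * (s * (a * D))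
    regroup = solve-∀

  count : (X → Bool) → List X → ℕ
  count p []       = 0
  count p (x ∷ xs) = if p x then suc (count p xs) else count p xs

  count-++ : ∀ (p : X → Bool) xs ys → count p (xs ++ ys) ≡ count p xs ℕ.+ count p ys
  count-++ p []       ys = refl
  count-++ p (x ∷ xs) ys with p x
  ... | true  = cong suc (count-++ p xs ys)
  ... | false = count-++ p xs ys

  count-all : ∀ (p : X → Bool) {xs} → All (T ∘ p) xs → count p xs ≡ length xs
  count-all p {[]}     []         = refl
  count-all p {x ∷ xs} (px ∷ pxs) with p x
  ... | true = cong suc (count-all p pxs)

  count-none : ∀ (p : X → Bool) {xs} → All (T ∘ not ∘ p) xs → count p xs ≡ 0
  count-none p {[]}     []         = refl
  count-none p {x ∷ xs} (px ∷ pxs) with p x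
  ... | false = count-none p pxs

  count+count-not : ∀ (p : X → Bool) xs → count p xs ℕ.+ count (not ∘ p) xs ≡ length xs
  count+count-not p []       = refl
  count+count-not p (x ∷ xs) with p x
  ... | true  = cong suc (count+count-not p xs)
  ... | false = trans (ℕ.+-suc (count p xs) _) (cong suc (count+count-not p xs))

  length≤count-++ : ∀ (p : X → Bool) xs {ys} → All (T ∘ p) ys → length ys ℕ.≤ count p (xs ++ ys)
  length≤count-++ p xs {ys} pys = begin
    length ys                      ≡⟨ count-all p pys ⟨
    count p ys                     ≤⟨ ℕ.m≤n+m (count p ys) (count p xs) ⟩
    count p xs ℕ.+ count p ys      ≡⟨ count-++ p xs ys ⟨
    count p (xs ++ ys)             ∎
    where open ℕ.≤-Reasoning

  count-≤-∷ : ∀ (p : X → Bool) x xs → count p xs ℕ.≤ count p (x ∷ xs)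
  count-≤-∷ p x xs with p x
  ... | true  = ℕ.n≤1+n _
  ... | false = ℕ.≤-refl

  count-∷-mono : ∀ (p : X → Bool) x {xs ys} →
                 count p xs ℕ.≤ count p ys → count p (x ∷ xs) ℕ.≤ count p (x ∷ ys)
  count-∷-mono p x c with p x
  ... | true  = s≤s c
  ... | false = c

  Pick-count : ∀ (p : X → Bool) {xs c rest} → Pick xs c rest → count p xs ≡ count p (c ∷ rest)
  Pick-count p here = refl
  Pick-count p {x ∷ xs} {c} (there pick) with p x | p c | Pick-count p pick
  ... | true  | true  | eq = cong suc eq
  ... | true  | false | eq = cong suc eq
  ... | false | true  | eq = eq
  ... | false | false | eq = eq

  module _ {X Y : Set} (f : X → Y → ℤ) (p : X → Bool) (q : Y → Bool)
           (f-zero : ∀ r c → T (p r) → T (q c) → f r c ≡ 0ℤ) where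

    detOn-zero-block : ∀ R C → length R ℕ.< count p R ℕ.+ count q C → detOn f R C ≡ 0ℤ
    detOn-zero-block []      []      ()
    detOn-zero-block []      (_ ∷ _) _  = refl
    detOn-zero-block (r ∷ R) C       lt = ∑-pick-≡0 C term
      where
      entry-or-minor : ∀ c C′ → suc (length R) ℕ.< count p (r ∷ R) ℕ.+ count q (c ∷ C′) →
                       f r c ≡ 0ℤ ⊎ length R ℕ.< count p R ℕ.+ count q C′
      entry-or-minor c C′ lt′ with p r in pr | q c in qc
      ... | true  | true  = inj₁ (f-zero r c (subst T (sym pr) tt) (subst T (sym qc) tt))
      ... | true  | false = inj₂ (ℕ.s≤s⁻¹ lt′)
      ... | false | true  = inj₂ (ℕ.s≤s⁻¹ (subst (suc (suc (length R)) ℕ.≤_) (ℕ.+-suc _ _) lt′))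
      ... | false | false = inj₂ (ℕ.<⇒≤ lt′)
      zero-entry : ∀ s D → s * (0ℤ * D) ≡ 0ℤ
      zero-entry = solve-∀
      term : ∀ j {c C′} → Pick C c C′ → sgn j * (f r c * detOn f R C′) ≡ 0ℤ
      term j {c} {C′} pick
        with entry-or-minor c C′ (subst (λ n → suc (length R) ℕ.< count p (r ∷ R) ℕ.+ n)
                                        (Pick-count q pick) lt)
      ... | inj₁ f≡0 = trans (cong (λ a → sgn j * (a * detOn f R C′)) f≡0)
                             (zero-entry (sgn j) (detOn f R C′))
      ... | inj₂ lt″ = trans (cong (λ D → sgn j * (f r c * D)) (detOn-zero-block R C′ lt″))
                             (zeroʳ₂ (sgn j) (f r c))

    detOn-zero-block-corner : ∀ Rt Rb C Cr → All (T ∘ p) Rb → All (T ∘ q) Cr →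
      suc (length Rt) ≡ length Cr → detOn f (Rt ++ Rb) (C ++ Cr) ≡ 0ℤ
    detOn-zero-block-corner Rt Rb C Cr pRb qCr |Rt|<|Cr| = detOn-zero-block (Rt ++ Rb) (C ++ Cr) (begin-strict
      length (Rt ++ Rb)                        ≡⟨ List.length-++ Rt ⟩
      length Rt ℕ.+ length Rb                  ≡⟨ ℕ.+-comm (length Rt) _ ⟩
      length Rb ℕ.+ length Rt                  <⟨ ℕ.+-monoʳ-< (length Rb) (ℕ.n<1+n _) ⟩
      length Rb ℕ.+ suc (length Rt)            ≡⟨ cong (length Rb ℕ.+_) |Rt|<|Cr| ⟩
      length Rb ℕ.+ length Cr                  ≤⟨ ℕ.+-mono-≤ (length≤count-++ p Rt pRb)
                                                                (length≤count-++ q C qCr) ⟩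
      count p (Rt ++ Rb) ℕ.+ count q (C ++ Cr) ∎)
      where open ℕ.≤-Reasoning

    detOn-block-antitriangular : ∀ Rt Rb Cl Cr → All (T ∘ p) Rb → All (T ∘ q) Cr →
      length Rt ≡ length Cr → length Rb ≡ length Cl →
      detOn f (Rt ++ Rb) (Cl ++ Cr) ≡ sgn (length Cl) ^ length Rt * (detOn f Rt Cr * detOn f Rb Cl)
    detOn-block-antitriangular [] Rb Cl [] _ _ _ _ = begin
      detOn f Rb (Cl ++ [])      ≡⟨ cong (detOn f Rb) (List.++-identityʳ Cl) ⟩
      detOn f Rb Cl              ≡⟨ ℤ.*-identityˡ _ ⟨
      1ℤ * detOn f Rb Cl         ≡⟨ ℤ.*-identityˡ _ ⟨
      1ℤ * (1ℤ * detOn f Rb Cl)  ∎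
      where open ≡-Reasoning
    detOn-block-antitriangular (t ∷ Rt) Rb Cl Cr pRb qCr |Rt|≡|Cr| |Rb|≡|Cl| = begin
      ∑-pick h (Cl ++ Cr)
        ≡⟨ ∑-pick-++ h Cl Cr ⟩
      ∑-pick (λ j c C′ → h j c (C′ ++ Cr)) Cl
        + ∑-pick (λ k c C′ → h (length Cl ℕ.+ k) c (Cl ++ C′)) Cr
        ≡⟨ cong₂ _+_ (∑-pick-≡0 Cl minor-vanishes) (∑-pick-cong-on Cr minor-splits) ⟩
      0ℤ + ∑-pick (λ k c C′ → K * (sgn k * (f t c * detOn f Rt C′))) Cr
        ≡⟨ trans (ℤ.+-identityˡ _) (sym (*-distribˡ-∑-pick K _ Cr)) ⟩
      K * detOn f (t ∷ Rt) Cr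
        ≡⟨ regroup (s ^ length Rt) s (detOn f Rb Cl) (detOn f (t ∷ Rt) Cr) ⟩
      s ^ suc (length Rt) * (detOn f (t ∷ Rt) Cr * detOn f Rb Cl) ∎
      where
      open ≡-Reasoning
      s : ℤ
      s = sgn (length Cl)
      K : ℤ
      K = s ^ length Rt * (s * detOn f Rb Cl)
      h : ℕ → Y → List Y → ℤ
      h j c C′ = sgn j * (f t c * detOn f (Rt ++ Rb) C′)
      regroup : ∀ P s D X → (P * (s * D)) * X ≡ (s * P) * (X * D)
      regroup = solve-∀
      factor : ∀ s k a P D B → s * k * (a * (P * (D * B))) ≡ (P * (s * B)) * (k * (a * D))
      factor = solve-∀
      minor-vanishes : ∀ j {c C′} → Pick Cl c C′ → h j c (C′ ++ Cr) ≡ 0ℤ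
      minor-vanishes j {c} {C′} _ =
        trans (cong (λ D → sgn j * (f t c * D)) (detOn-zero-block-corner Rt Rb C′ Cr pRb qCr |Rt|≡|Cr|))
              (zeroʳ₂ (sgn j) (f t c))
      minor-splits : ∀ k {c C′} → Pick Cr c C′ →
        h (length Cl ℕ.+ k) c (Cl ++ C′) ≡ K * (sgn k * (f t c * detOn f Rt C′))
      minor-splits k {c} {C′} pick = begin
        sgn (length Cl ℕ.+ k) * (f t c * detOn f (Rt ++ Rb) (Cl ++ C′))
          ≡⟨ cong₂ (λ u D → u * (f t c * D)) (sgn-+ (length Cl) k)
               (detOn-block-antitriangular Rt Rb Cl C′ pRb (Pick-All qCr pick)
                 (ℕ.suc-injective (trans |Rt|≡|Cr| (Pick-length pick))) |Rb|≡|Cl|) ⟩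
        s * sgn k * (f t c * (s ^ length Rt * (detOn f Rt C′ * detOn f Rb Cl)))
          ≡⟨ factor s (sgn k) (f t c) (s ^ length Rt) (detOn f Rt C′) (detOn f Rb Cl) ⟩
        K * (sgn k * (f t c * detOn f Rt C′)) ∎

    -- The inductive step of detOn-bordered: the terms of the first-row expansion
    -- whose entry lies in a border column.
    detOn-bordered-border-columns : ∀ t Rt Rb Cl Cr → All (T ∘ p) Rb → All (T ∘ q) Cr →
      length Rt ≡ length Cr → length Cl ≡ suc (length Rb) →
      (∀ C′ → All (T ∘ q) C′ → length Rt ≡ suc (length C′) →
         detOn f (Rt ++ Rb) (Cl ++ C′) ≡ sgn (length Rb) ^ length C′ *
           ∑-pick (λ i t Rt′ → sgn i * (detOn f Rt′ C′ * detOn f (t ∷ Rb) Cl)) Rt) →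
      ∑-pick (λ k c C′ → sgn (length Cl ℕ.+ k) * (f t c * detOn f (Rt ++ Rb) (Cl ++ C′))) Cr
        ≡ sgn (length Rb) ^ length Cr *
          ∑-pick (λ i u Rt′ → sgn (suc i) * (detOn f (t ∷ Rt′) Cr * detOn f (u ∷ Rb) Cl)) Rt

    detOn-bordered-border-columns t []       Rb Cl []      _   _   _ _ _ = refl
    detOn-bordered-border-columns t []       Rb Cl (_ ∷ _) _   _   () _ _
    detOn-bordered-border-columns t Rt@(_ ∷ Rt₀) Rb Cl Cr pRb qCr |Rt|≡|Cr| |Cl|≡1+|Rb| bordered-Rt = begin
      ∑-pick (λ k c C′ → sgn (length Cl ℕ.+ k) * (f t c * detOn f (Rt ++ Rb) (Cl ++ C′))) Cr
        ≡⟨ ∑-pick-cong-on Cr expand-minor ⟩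
      ∑-pick (λ k c C′ → ∑-pick (G k c C′) Rt) Cr
        ≡⟨ ∑-pick-comm (λ k c C′ → G k c C′) Cr Rt ⟩
      ∑-pick (λ i v Rt′ → ∑-pick (λ k c C′ → G k c C′ i v Rt′) Cr) Rt
        ≡⟨ ∑-pick-cong Rt collect-row-t ⟩
      ∑-pick (λ i v Rt′ → E * (sgn (suc i) * (detOn f (t ∷ Rt′) Cr * Z v))) Rt
        ≡⟨ *-distribˡ-∑-pick E (λ i v Rt′ → sgn (suc i) * (detOn f (t ∷ Rt′) Cr * Z v)) Rt ⟨
      E * ∑-pick (λ i v Rt′ → sgn (suc i) * (detOn f (t ∷ Rt′) Cr * Z v)) Rt ∎
      where
      open ≡-Reasoning
      s : ℤ
      s = sgn (length Rb)
      E : ℤ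
      E = s ^ length Cr
      P : ℤ
      P = s ^ length Rt₀
      Z : X → ℤ
      Z v = detOn f (v ∷ Rb) Cl
      G : ℕ → Y → List Y → ℕ → X → List X → ℤ
      G k c C′ i v Rt′ = ((sgn (length Cl) * sgn k) * (f t c * P)) * (sgn i * (detOn f Rt′ C′ * Z v))
      |Rt|≡|C′| : ∀ {c C′} → Pick Cr c C′ → length Rt ≡ suc (length C′)
      |Rt|≡|C′| pick = trans |Rt|≡|Cr| (Pick-length pick)
      regroup : ∀ x y a P W → x * y * (a * (P * W)) ≡ ((x * y) * (a * P)) * W
      regroup = solve-∀
      expand-minor : ∀ k {c C′} → Pick Cr c C′ →
        sgn (length Cl ℕ.+ k) * (f t c * detOn f (Rt ++ Rb) (Cl ++ C′)) ≡ ∑-pick (G k c C′) Rt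
      expand-minor k {c} {C′} pick = trans
        (cong₂ (λ σ D → σ * (f t c * D)) (sgn-+ (length Cl) k)
          (trans (bordered-Rt C′ (Pick-All qCr pick) (|Rt|≡|C′| pick))
                 (cong (λ n → s ^ n * W) (ℕ.suc-injective (sym (|Rt|≡|C′| pick))))))
        (trans (regroup (sgn (length Cl)) (sgn k) (f t c) P W)
               (*-distribˡ-∑-pick ((sgn (length Cl) * sgn k) * (f t c * P))
                  (λ i v Rt′ → sgn i * (detOn f Rt′ C′ * Z v)) Rt))
        where
        W : ℤ
        W = ∑-pick (λ i v Rt′ → sgn i * (detOn f Rt′ C′ * Z v)) Rt
      shuffle : ∀ x y a P σ D Z → ((x * y) * (a * P)) * (σ * (D * Z)) ≡ (x * P * σ * Z) * (y * (a * D))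
      shuffle = solve-∀
      unshuffle : ∀ s P σ Z D → (- s * P * σ * Z) * D ≡ (s * P) * (- σ * (D * Z))
      unshuffle = solve-∀
      collect-row-t : ∀ i v Rt′ → ∑-pick (λ k c C′ → G k c C′ i v Rt′) Cr
                                ≡ E * (sgn (suc i) * (detOn f (t ∷ Rt′) Cr * Z v))
      collect-row-t i v Rt′ = begin
        ∑-pick (λ k c C′ → G k c C′ i v Rt′) Cr
          ≡⟨ ∑-pick-cong Cr (λ k c C′ →
               shuffle (sgn (length Cl)) (sgn k) (f t c) P (sgn i) (detOn f Rt′ C′) (Z v)) ⟩
        ∑-pick (λ k c C′ → (sgn (length Cl) * P * sgn i * Z v) * (sgn k * (f t c * detOn f Rt′ C′))) Cr
          ≡⟨ *-distribˡ-∑-pick (sgn (length Cl) * P * sgn i * Z v) _ Cr ⟨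
        (sgn (length Cl) * P * sgn i * Z v) * detOn f (t ∷ Rt′) Cr
          ≡⟨ cong (λ σ → (σ * P * sgn i * Z v) * detOn f (t ∷ Rt′) Cr)
                  (trans (cong sgn |Cl|≡1+|Rb|) (sgn-suc (length Rb))) ⟩
        (- s * P * sgn i * Z v) * detOn f (t ∷ Rt′) Cr
          ≡⟨ unshuffle s P (sgn i) (Z v) (detOn f (t ∷ Rt′) Cr) ⟩
        (s * P) * (- sgn i * (detOn f (t ∷ Rt′) Cr * Z v))
          ≡⟨ cong₂ (λ e σ → e * (σ * (detOn f (t ∷ Rt′) Cr * Z v)))
                   (cong (s ^_) |Rt|≡|Cr|) (sym (sgn-suc i)) ⟩
        E * (sgn (suc i) * (detOn f (t ∷ Rt′) Cr * Z v)) ∎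

    -- Laplace expansion along the rows Rt: the zero block kills every
    -- complementary pair of minors except det(Rt − t, Cr) · det(t ∷ Rb, Cl).
    detOn-bordered : ∀ Rt Rb Cl Cr → All (T ∘ p) Rb → All (T ∘ q) Cr →
      length Rt ≡ suc (length Cr) → length Cl ≡ suc (length Rb) →
      detOn f (Rt ++ Rb) (Cl ++ Cr) ≡ sgn (length Rb) ^ length Cr *
        ∑-pick (λ i t Rt′ → sgn i * (detOn f Rt′ Cr * detOn f (t ∷ Rb) Cl)) Rt

    detOn-bordered [] Rb Cl Cr pRb qCr () |Cl|≡1+|Rb|
    detOn-bordered (t ∷ Rt) Rb Cl Cr pRb qCr |Rt|≡1+|Cr| |Cl|≡1+|Rb| = begin
      ∑-pick h (Cl ++ Cr)
        ≡⟨ ∑-pick-++ h Cl Cr ⟩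
      ∑-pick (λ j c C′ → h j c (C′ ++ Cr)) Cl
        + ∑-pick (λ k c C′ → h (length Cl ℕ.+ k) c (Cl ++ C′)) Cr
        ≡⟨ cong₂ _+_ first-term
             (detOn-bordered-border-columns t Rt Rb Cl Cr pRb qCr (ℕ.suc-injective |Rt|≡1+|Cr|) |Cl|≡1+|Rb|
               (λ C′ qC′ |Rt|≡1+|C′| → detOn-bordered Rt Rb Cl C′ pRb qC′ |Rt|≡1+|C′| |Cl|≡1+|Rb|)) ⟩
      E * (sgn 0 * (detOn f Rt Cr * detOn f (t ∷ Rb) Cl))
        + E * ∑-pick (λ i u Rt′ → sgn (suc i) * (detOn f (t ∷ Rt′) Cr * detOn f (u ∷ Rb) Cl)) Rt
        ≡⟨ ℤ.*-distribˡ-+ E _ _ ⟨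
      E * ∑-pick (λ i u Rt′ → sgn i * (detOn f Rt′ Cr * detOn f (u ∷ Rb) Cl)) (t ∷ Rt) ∎
      where
      open ≡-Reasoning
      E : ℤ
      E = sgn (length Rb) ^ length Cr
      h : ℕ → Y → List Y → ℤ
      h j c C′ = sgn j * (f t c * detOn f (Rt ++ Rb) C′)
      factor : ∀ s a E X D → s * (a * (E * (X * D))) ≡ (E * X) * (s * (a * D))
      factor = solve-∀
      unfactor : ∀ E X Z → (E * X) * Z ≡ E * (1ℤ * (X * Z))
      unfactor = solve-∀
      first-term : ∑-pick (λ j c C′ → h j c (C′ ++ Cr)) Cl
                   ≡ E * (sgn 0 * (detOn f Rt Cr * detOn f (t ∷ Rb) Cl))
      first-term = begin
        ∑-pick (λ j c C′ → h j c (C′ ++ Cr)) Cl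
          ≡⟨ ∑-pick-cong-on Cl (λ j {c} {C′} pick → trans
               (cong (λ D → sgn j * (f t c * D)) (trans
                 (detOn-block-antitriangular Rt Rb C′ Cr pRb qCr (ℕ.suc-injective |Rt|≡1+|Cr|)
                   (ℕ.suc-injective (trans (sym |Cl|≡1+|Rb|) (Pick-length pick))))
                 (cong₂ (λ m n → sgn m ^ n * (detOn f Rt Cr * detOn f Rb C′))
                   (ℕ.suc-injective (trans (sym (Pick-length pick)) |Cl|≡1+|Rb|))
                   (ℕ.suc-injective |Rt|≡1+|Cr|))))
               (factor (sgn j) (f t c) E (detOn f Rt Cr) (detOn f Rb C′))) ⟩
        ∑-pick (λ j c C′ → (E * detOn f Rt Cr) * (sgn j * (f t c * detOn f Rb C′))) Cl
          ≡⟨ *-distribˡ-∑-pick (E * detOn f Rt Cr) _ Cl ⟨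
        (E * detOn f Rt Cr) * detOn f (t ∷ Rb) Cl
          ≡⟨ unfactor E (detOn f Rt Cr) (detOn f (t ∷ Rb) Cl) ⟩
        E * (sgn 0 * (detOn f Rt Cr * detOn f (t ∷ Rb) Cl)) ∎

  i*j≡0⇒j≡0 : ∀ i {j} → i ≢ 0ℤ → i * j ≡ 0ℤ → j ≡ 0ℤ
  i*j≡0⇒j≡0 i i≢0 ij≡0 with ℤ.i*j≡0⇒i≡0∨j≡0 i ij≡0
  ... | inj₁ i≡0 = ⊥-elim (i≢0 i≡0)
  ... | inj₂ j≡0 = j≡0

  i*j≢0 : ∀ i j → i ≢ 0ℤ → j ≢ 0ℤ → i * j ≢ 0ℤ
  i*j≢0 i j i≢0 j≢0 ij≡0 = j≢0 (i*j≡0⇒j≡0 i i≢0 ij≡0)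

  JmI-sym : ∀ {n} (i j : Fin n) → JmI i j ≡ JmI j i
  JmI-sym zero    zero    = refl
  JmI-sym zero    (suc j) = refl
  JmI-sym (suc i) zero    = refl
  JmI-sym (suc i) (suc j) = JmI-sym i j

  ∑-JmI : ∀ {n} (y : Fin n → ℤ) b → ∑ (λ i → JmI i b * y i) ≡ ∑ y + - y b
  ∑-JmI y zero = begin
    0ℤ * y zero + ∑ (λ i → 1ℤ * y (suc i))  ≡⟨ ℤ.+-identityˡ _ ⟩
    ∑ (λ i → 1ℤ * y (suc i))                ≡⟨ ∑-cong (λ i → ℤ.*-identityˡ (y (suc i))) ⟩
    ∑ (y ∘ suc)                             ≡⟨ add-cancel (y zero) _ ⟩
    y zero + ∑ (y ∘ suc) + - y zero         ∎
    where
    open ≡-Reasoning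
    add-cancel : ∀ a s → s ≡ a + s + - a
    add-cancel = solve-∀
  ∑-JmI y (suc b) = begin
    1ℤ * y zero + ∑ (λ i → JmI i b * y (suc i))
      ≡⟨ cong₂ _+_ (ℤ.*-identityˡ (y zero)) (∑-JmI (y ∘ suc) b) ⟩
    y zero + (∑ (y ∘ suc) + - y (suc b))         ≡⟨ ℤ.+-assoc (y zero) _ _ ⟨
    y zero + ∑ (y ∘ suc) + - y (suc b)           ∎
    where open ≡-Reasoning

  -- With y the cofactors of the first column, the alien expansions along the other
  -- columns give y (suc b) = ∑ y, so ∑ y = y 0 + m ∑ y, whereas expanding along the
  -- first column gives det = ∑ y − y 0 = m ∑ y. Thus det = 0 forces ∑ y = 0 and y 0 = 0.
  det-J-I-step : ∀ m → det m JmI ≢ 0ℤ → + m ≢ 0ℤ → det (suc m) JmI ≢ 0ℤ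
  det-J-I-step m Dₘ≢0 m≢0 Dₘ₊₁≡0 = Dₘ≢0 (begin
    det m JmI              ≡⟨ det≡detOn m JmI suc suc ⟩
    _                      ≡⟨ ℤ.*-identityˡ _ ⟨
    y zero                 ≡⟨ y₀≡S-mS ⟩
    S + - (+ m * S)        ≡⟨ cong (λ s → s + - (+ m * s)) S≡0 ⟩
    0ℤ + - (+ m * 0ℤ)      ≡⟨ cong (λ a → 0ℤ + - a) (ℤ.*-zeroʳ (+ m)) ⟩
    0ℤ                     ∎)
    where
    open ≡-Reasoning
    Rs : List (Fin (suc m))
    Rs = tabulate (λ i → i)
    Cs : List (Fin (suc m))
    Cs = tabulate suc
    y : Fin (suc m) → ℤ
    y i = sgn (toℕ i) * detOn JmI (tabulate (punchIn i)) Cs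
    S : ℤ
    S = ∑ y
    cofactor-expansion : ∀ c → ∑ (λ i → JmI i c * y i)
      ≡ ∑-pick (λ i r R′ → sgn i * (JmI r c * detOn JmI R′ Cs)) Rs
    cofactor-expansion c = trans
      (∑-cong (λ i → swap-factor (sgn (toℕ i)) (JmI i c) (detOn JmI (tabulate (punchIn i)) Cs)))
      (sym (∑-pick-tabulate (λ i r R′ → sgn i * (JmI r c * detOn JmI R′ Cs)) (λ i → i)))
      where
      swap-factor : ∀ s a D → a * (s * D) ≡ s * (a * D)
      swap-factor = solve-∀
    det≡S-y₀ : det (suc m) JmI ≡ S + - y zero
    det≡S-y₀ = begin
      det (suc m) JmI              ≡⟨ det≡detOn (suc m) JmI (λ i → i) (λ i → i) ⟩
      detOn JmI Rs (zero ∷ Cs)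
        ≡⟨ detOn-expand-column JmI Rs zero Cs ⟩
      _                            ≡⟨ cofactor-expansion zero ⟨
      ∑ (λ i → JmI i zero * y i)   ≡⟨ ∑-JmI y zero ⟩
      S + - y zero                 ∎
    y-suc : ∀ b → y (suc b) ≡ S
    y-suc b with ∈-∃++ (∈-tabulate⁺ {f = suc {m}} b)
    ... | C₁ , C₂ , tabulate≡ = sym (ℤ.i-j≡0⇒i≡j S (y (suc b)) (begin
      S + - y (suc b)                 ≡⟨ ∑-JmI y (suc b) ⟨
      ∑ (λ i → JmI i (suc b) * y i)   ≡⟨ cofactor-expansion (suc b) ⟩
      ∑-pick (λ i r R′ → sgn i * (JmI r (suc b) * detOn JmI R′ Cs)) Rs
        ≡⟨ cong (λ C → ∑-pick (λ i r R′ → sgn i * (JmI r (suc b) * detOn JmI R′ C)) Rs)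
                tabulate≡ ⟩
      ∑-pick (λ i r R′ → sgn i * (JmI r (suc b) * detOn JmI R′ (C₁ ++ suc b ∷ C₂))) Rs
        ≡⟨ alien-expansion JmI Rs (suc b) C₁ C₂ ⟩
      0ℤ                              ∎))
    S≡y₀+mS : S ≡ y zero + + m * S
    S≡y₀+mS = cong (_+_ (y zero)) (trans (∑-cong y-suc) (∑-const m S))
    y₀≡S-mS : y zero ≡ S + - (+ m * S)
    y₀≡S-mS = trans (add-sub (y zero) (+ m * S)) (cong (λ s → s + - (+ m * S)) (sym S≡y₀+mS))
      where
      add-sub : ∀ a b → a ≡ a + b + - b
      add-sub = solve-∀
    S≡0 : S ≡ 0ℤ
    S≡0 = i*j≡0⇒j≡0 (+ m) m≢0 (begin
      + m * S                  ≡⟨ add-sub′ (y zero) (+ m * S) ⟩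
      y zero + + m * S + - y zero ≡⟨ cong (λ s → s + - y zero) S≡y₀+mS ⟨
      S + - y zero             ≡⟨ det≡S-y₀ ⟨
      det (suc m) JmI          ≡⟨ Dₘ₊₁≡0 ⟩
      0ℤ                       ∎)
      where
      add-sub′ : ∀ a b → b ≡ a + b + - a
      add-sub′ = solve-∀

  det-J-I≢0 : ∀ k → det (suc (suc k)) JmI ≢ 0ℤ
  det-J-I≢0 zero    ()
  det-J-I≢0 (suc k) = det-J-I-step (suc (suc k)) (det-J-I≢0 k) (λ ())

  ∑ₗ : (X → ℤ) → List X → ℤ
  ∑ₗ g xs = foldr _+_ 0ℤ (map g xs)

  ∑ₗ-++ : ∀ (g : X → ℤ) xs ys → ∑ₗ g (xs ++ ys) ≡ ∑ₗ g xs + ∑ₗ g ys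
  ∑ₗ-++ g []       ys = sym (ℤ.+-identityˡ _)
  ∑ₗ-++ g (x ∷ xs) ys = trans (cong (_+_ (g x)) (∑ₗ-++ g xs ys)) (sym (ℤ.+-assoc (g x) _ _))

  ∑ₗ-map : ∀ (g : Y → ℤ) (h : X → Y) xs → ∑ₗ g (map h xs) ≡ ∑ₗ (g ∘ h) xs
  ∑ₗ-map g h []       = refl
  ∑ₗ-map g h (x ∷ xs) = cong (_+_ (g (h x))) (∑ₗ-map g h xs)

  ∑ₗ-cong-All : ∀ {P : X → Set} {g h : X → ℤ} {xs} → All P xs → (∀ {x} → P x → g x ≡ h x) →
                ∑ₗ g xs ≡ ∑ₗ h xs
  ∑ₗ-cong-All []         g≗h = refl
  ∑ₗ-cong-All (px ∷ pxs) g≗h = cong₂ _+_ (g≗h px) (∑ₗ-cong-All pxs g≗h)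

  ∑ₗ-cong : ∀ {g h : X → ℤ} xs → (∀ x → g x ≡ h x) → ∑ₗ g xs ≡ ∑ₗ h xs
  ∑ₗ-cong []       g≗h = refl
  ∑ₗ-cong (x ∷ xs) g≗h = cong₂ _+_ (g≗h x) (∑ₗ-cong xs g≗h)

  ∑ₗ-≡0 : ∀ {g : X → ℤ} {xs} → All (λ x → g x ≡ 0ℤ) xs → ∑ₗ g xs ≡ 0ℤ
  ∑ₗ-≡0 []           = refl
  ∑ₗ-≡0 (gx≡0 ∷ gxs) = cong₂ _+_ gx≡0 (∑ₗ-≡0 gxs)

  *-distribˡ-∑ₗ : ∀ k (g : X → ℤ) xs → k * ∑ₗ g xs ≡ ∑ₗ (λ x → k * g x) xs
  *-distribˡ-∑ₗ k g []       = ℤ.*-zeroʳ k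
  *-distribˡ-∑ₗ k g (x ∷ xs) =
    trans (ℤ.*-distribˡ-+ k (g x) _) (cong (_+_ (k * g x)) (*-distribˡ-∑ₗ k g xs))

  ∑ₗ-pos : ∀ {g : X → ℤ} {xs} → All (λ x → 0ℤ ℤ.≤ g x) xs → Any (λ x → 0ℤ ℤ.< g x) xs →
           0ℤ ℤ.< ∑ₗ g xs
  ∑ₗ-pos (_ ∷ nonneg) (Any.here pos)    = ℤ.+-mono-<-≤ pos (∑ₗ-nonneg nonneg)
    where
    ∑ₗ-nonneg : ∀ {g : X → ℤ} {xs} → All (λ x → 0ℤ ℤ.≤ g x) xs → 0ℤ ℤ.≤ ∑ₗ g xs
    ∑ₗ-nonneg []          = ℤ.≤-refl
    ∑ₗ-nonneg (gx ∷ gxs)  = ℤ.+-mono-≤ gx (∑ₗ-nonneg gxs)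
  ∑ₗ-pos (gx ∷ nonneg)  (Any.there pos) = ℤ.+-mono-≤-< gx (∑ₗ-pos nonneg pos)

  sublists : ℕ → List X → List (List X)
  sublists zero    xs       = [] ∷ []
  sublists (suc k) []       = []
  sublists (suc k) (x ∷ xs) = sublists (suc k) xs ++ map (x ∷_) (sublists k xs)

  sublists-All : ∀ {P : X → Set} k {xs} → All P xs → All (All P) (sublists k xs)
  sublists-All zero    _          = [] ∷ []
  sublists-All (suc k) []         = []
  sublists-All (suc k) (px ∷ pxs) =
    All.++⁺ (sublists-All (suc k) pxs) (All.map⁺ (All.map (px ∷_) (sublists-All k pxs)))

  sublists-length-count : ∀ (p : X → Bool) k xs →
    All (λ S → length S ≡ k × count p S ℕ.≤ count p xs) (sublists k xs)
  sublists-length-count p zero    xs       = (refl , z≤n) ∷ []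
  sublists-length-count p (suc k) []       = []
  sublists-length-count p (suc k) (x ∷ xs) =
    All.++⁺ (All.map (λ (|S| , c) → |S| , ℕ.≤-trans c (count-≤-∷ p x xs))
                     (sublists-length-count p (suc k) xs))
            (All.map⁺ (All.map (λ {S} (|S| , c) → cong suc |S| , count-∷-mono p x {S} {xs} c)
                               (sublists-length-count p k xs)))

  prefix∈sublists : ∀ (xs ys : List X) → Any (xs ≡_) (sublists (length xs) (xs ++ ys))
  prefix∈sublists []       ys = Any.here refl
  prefix∈sublists (x ∷ xs) ys =
    Any.++⁺ʳ (sublists (suc (length xs)) (xs ++ ys))
             (Any.map⁺ (Any.map (cong (x ∷_)) (prefix∈sublists xs ys)))

  ∑ₗ-increasing : ∀ n k (ρ : Fin n → X) (H : List X → ℤ) →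
    ∑ₗ (λ σ → H (tabulate (ρ ∘ σ))) (increasing n k) ≡ ∑ₗ H (sublists k (tabulate ρ))
  ∑ₗ-increasing n       zero    ρ H = refl
  ∑ₗ-increasing zero    (suc k) ρ H = refl
  ∑ₗ-increasing {X = X} (suc n) (suc k) ρ H = begin
    ∑ₗ Hρ (map (suc ∘_) (increasing n (suc k)) ++ map _ (increasing n k))
      ≡⟨ ∑ₗ-++ Hρ (map (suc ∘_) (increasing n (suc k))) _ ⟩
    ∑ₗ Hρ (map (suc ∘_) (increasing n (suc k))) + ∑ₗ Hρ (map _ (increasing n k))
      ≡⟨ cong₂ _+_ (trans (∑ₗ-map Hρ _ (increasing n (suc k))) (∑ₗ-increasing n (suc k) ρ′ H))
                   (trans (∑ₗ-map Hρ _ (increasing n k)) (∑ₗ-increasing n k ρ′ (H ∘ (ρ zero ∷_)))) ⟩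
    ∑ₗ H (sublists (suc k) τ) + ∑ₗ (H ∘ (ρ zero ∷_)) (sublists k τ)
      ≡⟨ cong (_+_ (∑ₗ H (sublists (suc k) τ))) (∑ₗ-map H (ρ zero ∷_) (sublists k τ)) ⟨
    ∑ₗ H (sublists (suc k) τ) + ∑ₗ H (map (ρ zero ∷_) (sublists k τ))
      ≡⟨ ∑ₗ-++ H (sublists (suc k) τ) _ ⟨
    ∑ₗ H (sublists (suc k) (tabulate ρ)) ∎
    where
    open ≡-Reasoning
    Hρ : ∀ {m} → (Fin m → Fin (suc n)) → ℤ
    Hρ σ = H (tabulate (ρ ∘ σ))
    ρ′ : Fin n → X
    ρ′ = ρ ∘ suc
    τ : List X
    τ = tabulate ρ′

  sumPrincipalMinors-sublists : ∀ n k (f : X → X → ℤ) (ρ : Fin n → X) →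
    sumPrincipalMinors n k (λ i j → f (ρ i) (ρ j)) ≡ ∑ₗ (λ S → detOn f S S) (sublists k (tabulate ρ))
  sumPrincipalMinors-sublists n k f ρ =
    trans (∑ₗ-cong (increasing n k) (λ σ → det≡detOn k f (ρ ∘ σ) (ρ ∘ σ)))
          (∑ₗ-increasing n k ρ (λ S → detOn f S S))

  ∑ₗ-sublists-forced : ∀ (p : X → Bool) (H : List X → ℤ) xs ys k → All (T ∘ p) xs → All (T ∘ not ∘ p) ys →
    (∀ S → length S ≡ length xs ℕ.+ k → count p S ℕ.< length xs → H S ≡ 0ℤ) →
    ∑ₗ H (sublists (length xs ℕ.+ k) (xs ++ ys)) ≡ ∑ₗ (H ∘ (xs ++_)) (sublists k ys)
  ∑ₗ-sublists-forced p H []       ys k _          _   _         = refl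
  ∑ₗ-sublists-forced p H (x ∷ xs) ys k (px ∷ pxs) pys vanishing = begin
    ∑ₗ H (sublists (suc n ℕ.+ k) (xs ++ ys) ++ map (x ∷_) (sublists (n ℕ.+ k) (xs ++ ys)))
      ≡⟨ ∑ₗ-++ H (sublists (suc n ℕ.+ k) (xs ++ ys)) _ ⟩
    ∑ₗ H (sublists (suc n ℕ.+ k) (xs ++ ys)) + ∑ₗ H (map (x ∷_) (sublists (n ℕ.+ k) (xs ++ ys)))
      ≡⟨ cong₂ _+_ (∑ₗ-≡0 (All.map missing-x (sublists-length-count p (suc n ℕ.+ k) (xs ++ ys))))
                   (∑ₗ-map H (x ∷_) (sublists (n ℕ.+ k) (xs ++ ys))) ⟩
    0ℤ + ∑ₗ (H ∘ (x ∷_)) (sublists (n ℕ.+ k) (xs ++ ys))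
      ≡⟨ ℤ.+-identityˡ _ ⟩
    ∑ₗ (H ∘ (x ∷_)) (sublists (n ℕ.+ k) (xs ++ ys))
      ≡⟨ ∑ₗ-sublists-forced p (H ∘ (x ∷_)) xs ys k pxs pys vanishing-x∷ ⟩
    ∑ₗ (H ∘ ((x ∷ xs) ++_)) (sublists k ys) ∎
    where
    open ≡-Reasoning
    n : ℕ
    n = length xs
    count-xs++ys : count p (xs ++ ys) ≡ n
    count-xs++ys = trans (count-++ p xs ys)
                         (trans (cong₂ ℕ._+_ (count-all p pxs) (count-none p pys)) (ℕ.+-identityʳ n))
    missing-x : ∀ {S} → length S ≡ suc n ℕ.+ k × count p S ℕ.≤ count p (xs ++ ys) → H S ≡ 0ℤ
    missing-x {S} (|S| , c) = vanishing S |S| (s≤s (subst (count p S ℕ.≤_) count-xs++ys c))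
    vanishing-x∷ : ∀ S → length S ≡ n ℕ.+ k → count p S ℕ.< n → H (x ∷ S) ≡ 0ℤ
    vanishing-x∷ S |S| c = vanishing (x ∷ S) (cong suc |S|) (subst (ℕ._< suc n) (sym (count-∷ px)) (s≤s c))
      where
      count-∷ : T (p x) → count p (x ∷ S) ≡ suc (count p S)
      count-∷ px with p x
      ... | true = refl

  a+b<b+b : ∀ {a b l m} → a ℕ.+ b ≡ l ℕ.+ m → a ℕ.≤ m → m ℕ.< l → a ℕ.+ b ℕ.< b ℕ.+ b
  a+b<b+b {a} {b} {l} {m} a+b≡l+m a≤m m<l = ℕ.+-monoˡ-< b (ℕ.≤-<-trans a≤m (ℕ.<-≤-trans m<l l≤b))
    where
    l≤b : l ℕ.≤ b
    l≤b = ℕ.+-cancelʳ-≤ m l b (subst (ℕ._≤ b ℕ.+ m) a+b≡l+m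
            (subst (a ℕ.+ b ℕ.≤_) (ℕ.+-comm m b) (ℕ.+-monoˡ-≤ b a≤m)))

  inBlock₁ : ∀ {l} → Block l → Bool
  inBlock₁ (blk₁ _) = true
  inBlock₁ (blk₂ _) = false
  inBlock₁ blk₃     = false

  outside₁ : ∀ {l} → Block l → Set
  outside₁ = T ∘ not ∘ inBlock₁

  Aentry-zero : ∀ l d r c → outside₁ r → outside₁ c → Aentry l d r c ≡ 0ℤ
  Aentry-zero l d (blk₂ _) (blk₂ _) _ _ = refl
  Aentry-zero l d (blk₂ _) blk₃     _ _ = refl
  Aentry-zero l d blk₃     (blk₂ _) _ _ = refl
  Aentry-zero l d blk₃     blk₃     _ _ = refl

  Aentry-sym : ∀ l d x y → Aentry l d x y ≡ Aentry l d y x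
  Aentry-sym l d (blk₁ a) (blk₁ b) = cong (+ (2 ℕ.* d) *_) (JmI-sym a b)
  Aentry-sym l d (blk₁ a) (blk₂ b) = cong (+ suc d *_) (JmI-sym a b)
  Aentry-sym l d (blk₁ a) blk₃     = refl
  Aentry-sym l d (blk₂ a) (blk₁ b) = cong (+ suc d *_) (JmI-sym a b)
  Aentry-sym l d (blk₂ a) (blk₂ b) = refl
  Aentry-sym l d (blk₂ a) blk₃     = refl
  Aentry-sym l d blk₃     (blk₁ b) = refl
  Aentry-sym l d blk₃     (blk₂ b) = refl
  Aentry-sym l d blk₃     blk₃     = refl

  tabulate-++ : ∀ m n (g : Fin (m ℕ.+ n) → X) →
    tabulate g ≡ tabulate (λ i → g (i ↑ˡ n)) ++ tabulate (λ i → g (m ↑ʳ i))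
  tabulate-++ zero    n g = refl
  tabulate-++ (suc m) n g = cong (g zero ∷_) (tabulate-++ m n (g ∘ suc))

  tabulate-block : ∀ l → tabulate (block l) ≡ tabulate blk₁ ++ (tabulate blk₂ ++ blk₃ ∷ [])
  tabulate-block l = trans (tabulate-++ l (l ℕ.+ 1) (block l))
    (cong₂ _++_ (List.tabulate-cong block-↑ˡ)
      (trans (tabulate-++ l 1 _) (cong₂ _++_ (List.tabulate-cong block-↑ʳ-↑ˡ) (List.tabulate-cong block-↑ʳ-↑ʳ))))
    where
    block-↑ˡ : ∀ i → block l (i ↑ˡ (l ℕ.+ 1)) ≡ blk₁ i
    block-↑ˡ i rewrite Fin.splitAt-↑ˡ l i (l ℕ.+ 1) = refl
    block-↑ʳ-↑ˡ : ∀ j → block l (l ↑ʳ (j ↑ˡ 1)) ≡ blk₂ j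
    block-↑ʳ-↑ˡ j rewrite Fin.splitAt-↑ʳ l (l ℕ.+ 1) (j ↑ˡ 1) | Fin.splitAt-↑ˡ l j 1 = refl
    block-↑ʳ-↑ʳ : ∀ k → block l (l ↑ʳ (l ↑ʳ k)) ≡ blk₃
    block-↑ʳ-↑ʳ k rewrite Fin.splitAt-↑ʳ l (l ℕ.+ 1) (l ↑ʳ k) | Fin.splitAt-↑ʳ l 1 k = refl

  JmI-form : ∀ {n} → (Fin n → ℤ) → ℤ
  JmI-form y = ∑ (λ i → y i * ∑ (λ j → JmI i j * y j))

  IminusJ-form : ∀ {n} → (Fin n → ℤ) → ℤ
  IminusJ-form y = ∑ (λ i → y i * y i) + - (∑ y * ∑ y)

  JmI-form≡-IminusJ-form : ∀ {n} (y : Fin n → ℤ) → JmI-form y ≡ - IminusJ-form y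
  JmI-form≡-IminusJ-form y = begin
    ∑ (λ i → y i * ∑ (λ j → JmI i j * y j))
      ≡⟨ ∑-cong (λ i → cong (y i *_) (trans (∑-cong (λ j → cong (_* y j) (JmI-sym i j))) (∑-JmI y i))) ⟩
    ∑ (λ i → y i * (∑ y + - y i))
      ≡⟨ ∑-cong (λ i → expand (y i) (∑ y)) ⟩
    ∑ (λ i → ∑ y * y i + - (y i * y i))
      ≡⟨ ∑-distrib-+ (λ i → ∑ y * y i) (λ i → - (y i * y i)) ⟩
    ∑ (λ i → ∑ y * y i) + ∑ (λ i → - (y i * y i))
      ≡⟨ cong₂ _+_ (*-distribˡ-∑ (∑ y) y) (sym (∑-neg (λ i → y i * y i))) ⟨
    ∑ y * ∑ y + - ∑ (λ i → y i * y i)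
      ≡⟨ negate (∑ y) (∑ (λ i → y i * y i)) ⟩
    - IminusJ-form y ∎
    where
    open ≡-Reasoning
    expand : ∀ a s → a * (s + - a) ≡ s * a + - (a * a)
    expand = solve-∀
    negate : ∀ s q → s * s + - q ≡ - (q + - (s * s))
    negate = solve-∀

  0≤i*i : ∀ i → 0ℤ ℤ.≤ i * i
  0≤i*i (+ zero)   = ℤ.+≤+ z≤n
  0≤i*i (+ suc n)  = ℤ.+≤+ z≤n
  0≤i*i (-[1+ n ]) = ℤ.+≤+ z≤n

  0<i*i : ∀ i → i ≢ 0ℤ → 0ℤ ℤ.< i * i
  0<i*i (+ zero)   i≢0 = ⊥-elim (i≢0 refl)
  0<i*i (+ suc n)  _   = ℤ.+<+ (s≤s z≤n)
  0<i*i (-[1+ n ]) _   = ℤ.+<+ (s≤s z≤n)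

  i≤i+j : ∀ i {j} → 0ℤ ℤ.≤ j → i ℤ.≤ i + j
  i≤i+j i {j} 0≤j = subst (ℤ._≤ i + j) (ℤ.+-identityʳ i) (ℤ.+-monoʳ-≤ i 0≤j)

  0≤∑-squares : ∀ {n} (y : Fin n → ℤ) → 0ℤ ℤ.≤ ∑ (λ i → y i * y i)
  0≤∑-squares {zero}  y = ℤ.≤-refl
  0≤∑-squares {suc n} y = ℤ.≤-trans (0≤i*i (y zero)) (i≤i+j _ (0≤∑-squares (y ∘ suc)))

  square≤∑-squares : ∀ {n} (y : Fin n → ℤ) b → y b * y b ℤ.≤ ∑ (λ i → y i * y i)
  square≤∑-squares y zero    = i≤i+j _ (0≤∑-squares (y ∘ suc))
  square≤∑-squares y (suc b) = ℤ.≤-trans (square≤∑-squares (y ∘ suc) b)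
    (subst (ℤ._≤ y zero * y zero + ∑ (λ i → y (suc i) * y (suc i))) (ℤ.+-identityˡ _)
           (ℤ.+-monoˡ-≤ (∑ (λ i → y (suc i) * y (suc i))) (0≤i*i (y zero))))

  IminusJ-form-nonneg : ∀ {n} (y : Fin n → ℤ) → ∑ y * ∑ y ℤ.≤ ∑ (λ i → y i * y i) → 0ℤ ℤ.≤ IminusJ-form y
  IminusJ-form-nonneg y = ℤ.i≤j⇒0≤j-i

  IminusJ-form-pos-if-∑≡0 : ∀ {n} (y : Fin n → ℤ) a → y a ≢ 0ℤ → ∑ y ≡ 0ℤ → 0ℤ ℤ.< IminusJ-form y
  IminusJ-form-pos-if-∑≡0 y a ya≢0 ∑y≡0 = ℤ.<-≤-trans (0<i*i (y a) ya≢0) (begin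
    y a * y a                                   ≤⟨ square≤∑-squares y a ⟩
    ∑ (λ i → y i * y i)                         ≡⟨ ℤ.+-identityʳ _ ⟨
    ∑ (λ i → y i * y i) + - (0ℤ * 0ℤ)           ≡⟨ cong (λ s → ∑ (λ i → y i * y i) + - (s * s)) ∑y≡0 ⟨
    IminusJ-form y                              ∎)
    where open ℤ.≤-Reasoning

  IminusJ-form-pos-if-∑≡y₁ : ∀ {n} (y : Fin (suc (suc n)) → ℤ) → y zero ≢ 0ℤ → y (suc zero) ≡ ∑ y →
                             0ℤ ℤ.< IminusJ-form y
  IminusJ-form-pos-if-∑≡y₁ y y₀≢0 y₁≡∑y = ℤ.<-≤-trans (0<i*i (y zero) y₀≢0) (begin
    y₀² ≡⟨ cancel y₀² y₁² ⟩
    y₀² + y₁² + - y₁²                           ≤⟨ ℤ.+-monoˡ-≤ (- y₁²) (subst (y₀² + y₁² ℤ.≤_) (ℤ.+-assoc y₀² y₁² _)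
                                                     (i≤i+j _ (0≤∑-squares (λ i → y (suc (suc i)))))) ⟩
    ∑ (λ i → y i * y i) + - y₁²                 ≡⟨ cong (λ s → ∑ (λ i → y i * y i) + - (s * s)) y₁≡∑y ⟩
    IminusJ-form y                              ∎)
    where
    open ℤ.≤-Reasoning
    y₀² : ℤ
    y₀² = y zero * y zero
    y₁² : ℤ
    y₁² = y (suc zero) * y (suc zero)
    cancel : ∀ a b → a ≡ a + b + - b
    cancel = solve-∀

  blocks₁ : ∀ l → List (Block l)
  blocks₁ l = tabulate blk₁

  blocks₂₃ : ∀ l → List (Block l)
  blocks₂₃ l = tabulate blk₂ ++ blk₃ ∷ []

  module Minors (m d : ℕ) where

    private
      L₁ : List (Block (suc m))
      L₁ = blocks₁ (suc m)
      Aₘ : Block (suc m) → Block (suc m) → ℤ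
      Aₘ = Aentry (suc m) d
      2d : ℤ
      2d = + (2 ℕ.* d)
      minor : List (Block (suc m)) → Fin (suc m) → ℤ
      minor T i = detOn Aₘ (tabulate (blk₁ ∘ punchIn i)) T

    -- The signed maximal minors of the border B = A[block 1, T]; they satisfy yᵀB = 0.
    cofactors : List (Block (suc m)) → Fin (suc m) → ℤ
    cofactors T i = sgn (toℕ i) * minor T i

    detOn-A-sym : ∀ R C → detOn Aₘ R C ≡ detOn Aₘ C R
    detOn-A-sym R C = trans (detOn-transpose Aₘ R C)
                            (detOn-cong (λ x y → Aentry-sym (suc m) d y x) C R)

    row₁-expansion : ∀ i T → detOn Aₘ (blk₁ i ∷ T) L₁ ≡ 2d * ∑ (λ j → JmI i j * cofactors T j)
    row₁-expansion i T = begin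
      detOn Aₘ (blk₁ i ∷ T) L₁
        ≡⟨ ∑-pick-tabulate (λ j c C′ → sgn j * (Aₘ (blk₁ i) c * detOn Aₘ T C′)) blk₁ ⟩
      ∑ (λ j → sgn (toℕ j) * ((2d * JmI i j) * detOn Aₘ T (tabulate (blk₁ ∘ punchIn j))))
        ≡⟨ ∑-cong (λ j → trans
             (cong (λ D → sgn (toℕ j) * ((2d * JmI i j) * D)) (detOn-A-sym T (tabulate (blk₁ ∘ punchIn j))))
             (regroup (sgn (toℕ j)) 2d (JmI i j) (minor T j))) ⟩
      ∑ (λ j → 2d * (JmI i j * cofactors T j))
        ≡⟨ *-distribˡ-∑ 2d (λ j → JmI i j * cofactors T j) ⟨
      2d * ∑ (λ j → JmI i j * cofactors T j) ∎
      where
      open ≡-Reasoning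
      regroup : ∀ s k a D → s * ((k * a) * D) ≡ k * (a * (s * D))
      regroup = solve-∀

    principal-minor : ∀ T → All outside₁ T → length T ≡ m →
      detOn Aₘ (L₁ ++ T) (L₁ ++ T) ≡ - (sgn m ^ m * + (2 ℕ.* d)) * IminusJ-form (cofactors T)
    principal-minor T outside |T|≡m = begin
      detOn Aₘ (L₁ ++ T) (L₁ ++ T)
        ≡⟨ detOn-bordered Aₘ _ _ (Aentry-zero (suc m) d) L₁ T L₁ T outside outside |L₁|≡1+|T| |L₁|≡1+|T| ⟩
      sgn (length T) ^ length T * ∑-pick (λ i t R′ → sgn i * (detOn Aₘ R′ T * detOn Aₘ (t ∷ T) L₁)) L₁
        ≡⟨ cong₂ (λ n S → sgn n ^ n * S) |T|≡m
             (∑-pick-tabulate (λ i t R′ → sgn i * (detOn Aₘ R′ T * detOn Aₘ (t ∷ T) L₁)) blk₁) ⟩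
      sgn m ^ m * ∑ (λ i → sgn (toℕ i) * (minor T i * detOn Aₘ (blk₁ i ∷ T) L₁))
        ≡⟨ cong (sgn m ^ m *_) (∑-cong (λ i → trans
             (cong (λ D → sgn (toℕ i) * (minor T i * D)) (row₁-expansion i T))
             (regroup (sgn (toℕ i)) (minor T i) 2d (∑ (λ j → JmI i j * cofactors T j))))) ⟩
      sgn m ^ m * ∑ (λ i → 2d * (cofactors T i * ∑ (λ j → JmI i j * cofactors T j)))
        ≡⟨ cong (sgn m ^ m *_) (*-distribˡ-∑ 2d (λ i → cofactors T i * ∑ (λ j → JmI i j * cofactors T j))) ⟨
      sgn m ^ m * (2d * JmI-form (cofactors T))
        ≡⟨ cong (λ q → sgn m ^ m * (2d * q)) (JmI-form≡-IminusJ-form (cofactors T)) ⟩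
      sgn m ^ m * (2d * - IminusJ-form (cofactors T))
        ≡⟨ pull-neg (sgn m ^ m) 2d _ ⟩
      - (sgn m ^ m * 2d) * IminusJ-form (cofactors T) ∎
      where
      open ≡-Reasoning
      |L₁|≡1+|T| : length L₁ ≡ suc (length T)
      |L₁|≡1+|T| = trans (List.length-tabulate blk₁) (cong suc (sym |T|≡m))
      regroup : ∀ s D k I → s * (D * (k * I)) ≡ k * ((s * D) * I)
      regroup = solve-∀
      pull-neg : ∀ e t n → e * (t * - n) ≡ - (e * t) * n
      pull-neg = solve-∀

    alien-row₁ : ∀ x T′ → ∑ (λ i → Aₘ (blk₁ i) x * cofactors (x ∷ T′) i) ≡ 0ℤ
    alien-row₁ x T′ = begin
      ∑ (λ i → Aₘ (blk₁ i) x * cofactors (x ∷ T′) i)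
        ≡⟨ ∑-cong (λ i → swap-factor (Aₘ (blk₁ i) x) (sgn (toℕ i))
                                      (detOn Aₘ (tabulate (blk₁ ∘ punchIn i)) (x ∷ T′))) ⟩
      ∑ (λ i → sgn (toℕ i) * (Aₘ (blk₁ i) x * detOn Aₘ (tabulate (blk₁ ∘ punchIn i)) (x ∷ T′)))
        ≡⟨ ∑-pick-tabulate (λ i r R′ → sgn i * (Aₘ r x * detOn Aₘ R′ (x ∷ T′))) blk₁ ⟨
      ∑-pick (λ i r R′ → sgn i * (Aₘ r x * detOn Aₘ R′ (x ∷ T′))) L₁
        ≡⟨ alien-expansion Aₘ L₁ x [] T′ ⟩
      0ℤ ∎
      where
      open ≡-Reasoning
      swap-factor : ∀ a s D → a * (s * D) ≡ s * (a * D)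
      swap-factor = solve-∀

    cofactors-blk₂ : ∀ b T′ → cofactors (blk₂ b ∷ T′) b ≡ ∑ (cofactors (blk₂ b ∷ T′))
    cofactors-blk₂ b T′ = sym (ℤ.i-j≡0⇒i≡j _ _ (begin
      ∑ y + - y b                          ≡⟨ ∑-JmI y b ⟨
      ∑ (λ i → JmI i b * y i)              ≡⟨ i*j≡0⇒j≡0 (+ suc d) (λ ()) (begin
        + suc d * ∑ (λ i → JmI i b * y i)      ≡⟨ *-distribˡ-∑ (+ suc d) (λ i → JmI i b * y i) ⟩
        ∑ (λ i → + suc d * (JmI i b * y i))    ≡⟨ ∑-cong (λ i → ℤ.*-assoc (+ suc d) (JmI i b) (y i)) ⟨
        ∑ (λ i → + suc d * JmI i b * y i)      ≡⟨ alien-row₁ (blk₂ b) T′ ⟩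
        0ℤ                                     ∎) ⟩
      0ℤ                                   ∎))
      where
      open ≡-Reasoning
      y : Fin (suc m) → ℤ
      y = cofactors (blk₂ b ∷ T′)

    ∑-cofactors-blk₃ : d ≢ 0 → ∀ T′ → ∑ (cofactors (blk₃ ∷ T′)) ≡ 0ℤ
    ∑-cofactors-blk₃ d≢0 T′ = i*j≡0⇒j≡0 (+ d) (λ d≡0 → d≢0 (ℤ.+-injective d≡0))
      (trans (*-distribˡ-∑ (+ d) (cofactors (blk₃ ∷ T′))) (alien-row₁ blk₃ T′))

    IminusJ-form-cofactors-nonneg : d ≢ 0 → ∀ x T′ → outside₁ x →
                                    0ℤ ℤ.≤ IminusJ-form (cofactors (x ∷ T′))
    IminusJ-form-cofactors-nonneg d≢0 (blk₂ b) T′ _ = IminusJ-form-nonneg y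
      (subst (λ s → s * s ℤ.≤ ∑ (λ i → y i * y i)) (cofactors-blk₂ b T′) (square≤∑-squares y b))
      where
      y : Fin (suc m) → ℤ
      y = cofactors (blk₂ b ∷ T′)
    IminusJ-form-cofactors-nonneg d≢0 blk₃ T′ _ = IminusJ-form-nonneg y
      (subst (λ s → s * s ℤ.≤ ∑ (λ i → y i * y i)) (sym (∑-cofactors-blk₃ d≢0 T′)) (0≤∑-squares y))
      where
      y : Fin (suc m) → ℤ
      y = cofactors (blk₃ ∷ T′)

  open Minors

  IminusJ-form-cofactors-pos₁ : ∀ d → d ≢ 0 → 0ℤ ℤ.< IminusJ-form (cofactors 1 d (blk₃ ∷ []))
  IminusJ-form-cofactors-pos₁ d d≢0 =
    IminusJ-form-pos-if-∑≡0 (cofactors 1 d (blk₃ ∷ [])) zero y₀≢0 (∑-cofactors-blk₃ 1 d d≢0 [])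
    where
    y₀≡d : ∀ x → 1ℤ * (1ℤ * (x * 1ℤ) + 0ℤ) ≡ x
    y₀≡d = solve-∀
    y₀≢0 : cofactors 1 d (blk₃ ∷ []) zero ≢ 0ℤ
    y₀≢0 y₀≡0 = d≢0 (ℤ.+-injective (trans (sym (y₀≡d (+ d))) y₀≡0))

  IminusJ-form-cofactors-pos₂ : ∀ k d →
    0ℤ ℤ.< IminusJ-form (cofactors (suc (suc k)) d (tabulate (blk₂ ∘ suc)))
  IminusJ-form-cofactors-pos₂ k d = IminusJ-form-pos-if-∑≡y₁ y y₀≢0
    (cofactors-blk₂ (suc (suc k)) d (suc zero) (tabulate (λ i → blk₂ (suc (suc i)))))
    where
    m : ℕ
    m = suc (suc k)
    y : Fin (suc m) → ℤ
    y = cofactors m d (tabulate (blk₂ ∘ suc))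
    y₀≡ : y zero ≡ 1ℤ * ((+ suc d) ^ m * det m JmI)
    y₀≡ = cong (1ℤ *_) (trans (sym (det≡detOn m (Aentry (suc m) d) (blk₁ ∘ suc) (blk₂ ∘ suc)))
                              (det-scale m (+ suc d) JmI))
    1+d≢0 : + suc d ≢ 0ℤ
    1+d≢0 ()
    y₀≢0 : y zero ≢ 0ℤ
    y₀≢0 y₀≡0 = i*j≢0 1ℤ _ (λ ())
      (i*j≢0 ((+ suc d) ^ m) _ (λ p → 1+d≢0 (ℤ.i^n≡0⇒i≡0 (+ suc d) m p)) (det-J-I≢0 k))
      (trans (sym y₀≡) y₀≡0)

  blocks₂₃-outside₁ : ∀ l → All outside₁ (blocks₂₃ l)
  blocks₂₃-outside₁ l = All.++⁺ (All.tabulate⁺ (λ _ → tt)) (tt ∷ [])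

  sumPrincipalMinors-A : ∀ m d →
    sumPrincipalMinors (suc m ℕ.+ (suc m ℕ.+ 1)) ((suc m ℕ.+ suc m) ℕ.∸ 1) (A (suc m) d)
      ≡ - (sgn m ^ m * + (2 ℕ.* d)) * ∑ₗ (IminusJ-form ∘ cofactors m d) (sublists m (blocks₂₃ (suc m)))
  sumPrincipalMinors-A m d = begin
    sumPrincipalMinors (suc m ℕ.+ (suc m ℕ.+ 1)) (m ℕ.+ suc m) (A (suc m) d)
      ≡⟨ sumPrincipalMinors-sublists _ (m ℕ.+ suc m) (Aentry (suc m) d) (block (suc m)) ⟩
    ∑ₗ G (sublists (m ℕ.+ suc m) (tabulate (block (suc m))))
      ≡⟨ cong₂ (λ k xs → ∑ₗ G (sublists k xs)) (trans (ℕ.+-suc m m) (cong (ℕ._+ m) (sym |L₁|≡l)))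
               (tabulate-block (suc m)) ⟩
    ∑ₗ G (sublists (length L₁ ℕ.+ m) (L₁ ++ R))
      ≡⟨ ∑ₗ-sublists-forced inBlock₁ G L₁ R m (All.tabulate⁺ {f = blk₁} (λ _ → tt))
                           (blocks₂₃-outside₁ (suc m)) vanishing ⟩
    ∑ₗ (G ∘ (L₁ ++_)) (sublists m R)
      ≡⟨ ∑ₗ-cong-All (All.zip (sublists-All m (blocks₂₃-outside₁ (suc m))
                              , sublists-length-count inBlock₁ m R))
                     (λ (outside , |T|≡m , _) → principal-minor m d _ outside |T|≡m) ⟩
    ∑ₗ (λ T → c * IminusJ-form (cofactors m d T)) (sublists m R)
      ≡⟨ *-distribˡ-∑ₗ c (IminusJ-form ∘ cofactors m d) (sublists m R) ⟨
    c * ∑ₗ (IminusJ-form ∘ cofactors m d) (sublists m R) ∎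
    where
    open ≡-Reasoning
    L₁ R : List (Block (suc m))
    L₁ = blocks₁ (suc m)
    R  = blocks₂₃ (suc m)
    c : ℤ
    c = - (sgn m ^ m * + (2 ℕ.* d))
    G : List (Block (suc m)) → ℤ
    G S = detOn (Aentry (suc m) d) S S
    |L₁|≡l : length L₁ ≡ suc m
    |L₁|≡l = List.length-tabulate blk₁
    vanishing : ∀ S → length S ≡ length L₁ ℕ.+ m → count inBlock₁ S ℕ.< length L₁ → G S ≡ 0ℤ
    vanishing S |S| c₁<l = detOn-zero-block (Aentry (suc m) d) _ _ (Aentry-zero (suc m) d) S S
      (subst (ℕ._< count (not ∘ inBlock₁) S ℕ.+ count (not ∘ inBlock₁) S) (count+count-not inBlock₁ S)
        (a+b<b+b (trans (count+count-not inBlock₁ S) (trans |S| (cong (ℕ._+ m) |L₁|≡l)))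
                 (ℕ.s≤s⁻¹ (subst (count inBlock₁ S ℕ.<_) |L₁|≡l c₁<l)) (ℕ.n<1+n m)))

  coefficient≢0 : ∀ m d → d ≢ 0 → - (sgn m ^ m * + (2 ℕ.* d)) ≢ 0ℤ
  coefficient≢0 m d d≢0 c≡0 =
    i*j≢0 (sgn m ^ m) (+ (2 ℕ.* d)) (λ p → sgn≢0 m (ℤ.i^n≡0⇒i≡0 (sgn m) m p)) 2d≢0
      (trans (sym (ℤ.neg-involutive _)) (cong -_ c≡0))
    where
    2d≢0 : + (2 ℕ.* d) ≢ 0ℤ
    2d≢0 p = d≢0 (sym (ℕ.*-cancelˡ-≡ 0 d 2 (sym (ℤ.+-injective p))))

  some-IminusJ-form-pos : ∀ k d → d ≢ 0 →
    Any (λ T → 0ℤ ℤ.< IminusJ-form (cofactors (suc k) d T)) (sublists (suc k) (blocks₂₃ (suc (suc k))))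
  some-IminusJ-form-pos zero    d d≢0 = Any.here (IminusJ-form-cofactors-pos₁ d d≢0)
  some-IminusJ-form-pos (suc k) d _   = Any.++⁺ˡ (Any.map
    (λ T≡ → subst (λ T → 0ℤ ℤ.< IminusJ-form (cofactors (suc (suc k)) d T)) T≡
                  (IminusJ-form-cofactors-pos₂ k d))
    prefix)
    where
    Ts : List (Block (suc (suc (suc k))))
    Ts = tabulate (blk₂ ∘ suc)
    prefix : Any (Ts ≡_) (sublists (suc (suc k)) (Ts ++ blk₃ ∷ []))
    prefix = subst (λ n → Any (Ts ≡_) (sublists n (Ts ++ blk₃ ∷ []))) (List.length-tabulate (blk₂ ∘ suc))
                   (prefix∈sublists Ts (blk₃ ∷ []))

  ∑-IminusJ-forms-pos : ∀ k d → d ≢ 0 →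
    0ℤ ℤ.< ∑ₗ (IminusJ-form ∘ cofactors (suc k) d) (sublists (suc k) (blocks₂₃ (suc (suc k))))
  ∑-IminusJ-forms-pos k d d≢0 = ∑ₗ-pos
    (All.map (λ (outside , |T|≡m , _) → nonneg outside |T|≡m)
      (All.zip (sublists-All (suc k) (blocks₂₃-outside₁ (suc (suc k)))
              , sublists-length-count inBlock₁ (suc k) _)))
    (some-IminusJ-form-pos k d d≢0)
    where
    nonneg : ∀ {T} → All outside₁ T → length T ≡ suc k → 0ℤ ℤ.≤ IminusJ-form (cofactors (suc k) d T)
    nonneg {x ∷ T′} (px ∷ _) _ = IminusJ-form-cofactors-nonneg (suc k) d d≢0 x T′ px

open import Data.Nat using (_≤_; _<_; _+_; _∸_)
open import Data.Integer using (0ℤ)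
import Data.Integer.Properties as ℤ

lemma4p4 : (l d : ℕ) → 2 ≤ l → 0 < d →
    sumPrincipalMinors (l + (l + 1)) ((l + l) ∸ 1) (A l d) ≢ 0ℤ
lemma4p4 (suc (suc k)) d (s≤s (s≤s _)) 0<d sum≡0 =
  i*j≢0 _ _ (coefficient≢0 (suc k) d d≢0) (≢-sym (ℤ.<⇒≢ (∑-IminusJ-forms-pos k d d≢0)))
    (trans (sym (sumPrincipalMinors-A (suc k) d)) sum≡0)
  where
  d≢0 : d ≢ 0
  d≢0 = ℕ.>⇒≢ 0<d
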